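{- Let $V$ be a vector space of dimension $n$ over a finite field $\mathbb{F}$ of cardinality $q$, and let $V^*$ be its dual space (the set of linear functionals $V\to\mathbb{F}$). For $x \in V$ let $C_x = \{(\phi,\phi(x)) \in V^*\times\mathbb{F} \mid \phi \in V^*\}$. Then for any finite set $S \subseteq V^*\times\mathbb{F}$, the set $\mathcal{A}_S = \{x \in V \mid S \subseteq C_x\}$ has cardinality at most $q^n/|S|$. -}

module Defs where

open import Level using (Level; _⊔_)
open import Algebra.Bundles using (CommutativeRing)
open import Data.Nat using (ℕ)
open import Data.Fin using (Fin)
open import Data.Product using (Σ; _×_; _,_; ∃)
open import Data.List using (List)
open import Data.List.Relation.Unary.All using (All)
open import Relation.Nullary using (¬_)

record Field (c ℓ : Level) : Set (Level.suc (c ⊔ ℓ)) where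
  field
    commutativeRing : CommutativeRing c ℓ
  open CommutativeRing commutativeRing public
  field
    1≉0     : ¬ (1# ≈ 0#)
    inverse : ∀ x → ¬ (x ≈ 0#) → Σ Carrier (λ y → (x * y) ≈ 1#)

module _ {c ℓ : Level} (F : Field c ℓ) where
  open Field F

  Vec : ℕ → Set c
  Vec n = Fin n → Carrier

  _≈ᵥ_ : ∀ {n} → Vec n → Vec n → Set ℓ
  u ≈ᵥ v = ∀ i → u i ≈ v i

  _+ᵥ_ : ∀ {n} → Vec n → Vec n → Vec n
  (u +ᵥ v) i = u i + v i

  _·ᵥ_ : ∀ {n} → Carrier → Vec n → Vec n
  (a ·ᵥ v) i = a * v i

  record Dual (n : ℕ) : Set (c ⊔ ℓ) where
    field
      app      : Vec n → Carrier
      app-cong : ∀ {u v} → u ≈ᵥ v → app u ≈ app v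
      additive : ∀ u v → app (u +ᵥ v) ≈ (app u + app v)
      homog    : ∀ a v → app (a ·ᵥ v) ≈ (a * app v)
  open Dual public

  _≈*_ : ∀ {n} → Dual n → Dual n → Set (c ⊔ ℓ)
  φ ≈* ψ = ∀ v → app φ v ≈ app ψ v

  Pair : ℕ → Set (c ⊔ ℓ)
  Pair n = Dual n × Carrier

  _≈ₚ_ : ∀ {n} → Pair n → Pair n → Set (c ⊔ ℓ)
  (φ , a) ≈ₚ (ψ , b) = (φ ≈* ψ) × (a ≈ b)

  _∈C_ : ∀ {n} → Pair n → Vec n → Set (c ⊔ ℓ)
  p ∈C x = Σ (Dual _) (λ φ → (φ , app φ x) ≈ₚ p)

  _∈A_ : ∀ {n} → Vec _ → List (Pair n) → Set (c ⊔ ℓ)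
  x ∈A S = All (λ p → p ∈C x) S

-- Fix x₀ ∈ A_S. Every (φ , a) ∈ S satisfies a = φ(x₀), so S is determined by its set Φ of
-- functionals, and every x ∈ A_S gives a vector x − x₀ annihilated by all of Φ. It therefore
-- suffices to show |D| · |Φ| ≤ qⁿ whenever every functional of Φ annihilates every vector of D
-- (for subspaces this is dim U + dim U^⊥ = n). This is proved by induction on n, splitting off
-- the first coordinate. If every φ ∈ Φ vanishes on e₀, group D by first coordinate: within a
-- group vectors are determined by their tails, and the restrictions of Φ to the remaining
-- coordinates are distinct and annihilate those tails; q groups give the factor q. Otherwise
-- some φ₀ ∈ Φ has φ₀(e₀) ≠ 0; then vectors of D are determined by their tails, and grouping Φ
-- by the value at e₀ and eliminating the e₀-component with φ₀ gives q groups of distinct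
-- functionals in dimension n annihilating those tails.
module Submission where

open import Defs
open import Level using (Level; _⊔_)
open import Data.Bool using (true; false)
open import Data.Nat using (ℕ; zero; suc)
open import Data.Fin as Fin using (Fin; zero; suc)
open import Data.Product using (_×_; _,_; proj₁; proj₂)
open import Data.List using (List; []; _∷_; length; map; filter; tabulate)
open import Data.List.Properties using (length-map; length-tabulate)
open import Data.List.Relation.Unary.All as All using (All; []; _∷_)
import Data.List.Relation.Unary.All.Properties as Allₚ
open import Data.List.Relation.Unary.AllPairs as AllPairs using (AllPairs; []; _∷_)
import Data.List.Relation.Unary.AllPairs.Properties as AllPairsₚ
open import Data.List.Relation.Unary.Any as Any using (Any; here; there)
open import Data.List.Relation.Binary.Sublist.Propositional using (_⊆_)
import Data.List.Relation.Binary.Sublist.Propositional.Properties as Sublist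
import Data.List.Membership.Setoid as SetoidMembership
import Data.List.Membership.Setoid.Properties as SetoidMembershipₚ
open import Data.Vec.Functional as Vector using (head; tail)
open import Relation.Nullary using (¬_; does; yes; no)
open import Relation.Nullary.Decidable using (map′)
open import Relation.Nullary.Negation using (contradiction; contraposition)
open import Relation.Unary as U using (Pred)
open import Relation.Unary.Properties using (∁?)
open import Relation.Binary using (Rel; Setoid)
open import Relation.Binary.Definitions using (Decidable)
open import Relation.Binary.PropositionalEquality as ≡ using (_≡_)
open import Function.Base using (_∘_)
open import Function.Bundles using (Bijection; Surjection)
open import Algebra.Definitions using (AlmostLeftCancellative; AlmostRightCancellative)

Distinct : ∀ {a r} {A : Set a} → Rel A r → List A → Set (a ⊔ r)
Distinct _≈_ = AllPairs (λ x y → ¬ x ≈ y)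

module _ {a r : Level} {A : Set a} {R : Rel A r} where

  open import Data.Nat using (_≤_; z≤n; s≤s)

  Distinct-length≤1 : (∀ x y → R x y) → ∀ {xs} → Distinct R xs → length xs ≤ 1
  Distinct-length≤1 total []                          = z≤n
  Distinct-length≤1 total (_ ∷ [])                    = s≤s z≤n
  Distinct-length≤1 total {x ∷ y ∷ _} ((x≉y ∷ _) ∷ _) = contradiction (total x y) x≉y

module _ {a b p r s : Level} {A : Set a} {B : Set b} {P : Pred A p} {R : Rel A r} {S : Rel B s} where

  AllPairs-map⁺-on : (f : A → B) → (∀ {x y} → P x → P y → R x y → S (f x) (f y)) →
                     ∀ {xs} → All P xs → AllPairs R xs → AllPairs S (map f xs)
  AllPairs-map⁺-on f pres [] [] = []
  AllPairs-map⁺-on f pres (px ∷ pxs) (rx ∷ rxs) =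
    Allₚ.map⁺ (All.zipWith (λ (py , r) → pres px py r) (pxs , rx)) ∷ AllPairs-map⁺-on f pres pxs rxs

module _ {a b c d p q r s : Level} {A : Set a} {B : Set b} {C : Set c} {D : Set d}
         {P : Pred A p} {Q : Pred B q} {R : A → B → Set r} {S : C → D → Set s} where

  All-All-map⁺-on : (f : A → C) (g : B → D) → (∀ {x y} → P x → Q y → R x y → S (f x) (g y)) →
                    ∀ {xs ys} → All P xs → All Q ys → All (λ x → All (R x) ys) xs →
                    All (λ z → All (S z) (map g ys)) (map f xs)
  All-All-map⁺-on f g pres pxs qys rs = Allₚ.map⁺ (All.zipWith
    (λ (px , rx) → Allₚ.map⁺ (All.zipWith (λ (qy , r) → pres px qy r) (qys , rx)))
    (pxs , rs))

module _ {a p : Level} {A : Set a} {P : Pred A p} (P? : U.Decidable P) where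

  open import Data.Nat using (_+_)
  open import Data.Nat.Properties using (+-suc)

  length-filter+length-filter-∁ : ∀ xs → length (filter P? xs) + length (filter (∁? P?) xs) ≡ length xs
  length-filter+length-filter-∁ []       = ≡.refl
  length-filter+length-filter-∁ (x ∷ xs) with does (P? x)
  ... | true  = ≡.cong suc (length-filter+length-filter-∁ xs)
  ... | false = ≡.trans (+-suc _ _) (≡.cong suc (length-filter+length-filter-∁ xs))

module Fibres {k ℓ a : Level} (K : Setoid k ℓ) (_≟_ : Decidable (Setoid._≈_ K))
              {X : Set a} (key : X → Setoid.Carrier K) where

  open Setoid K using (Carrier; _≈_)
  open SetoidMembership K using (_∈_)
  open import Data.Nat using (_+_; _*_; _≤_; z≤n)
  open import Data.Nat.Properties using (*-distribʳ-+; +-mono-≤; *-monoˡ-≤; ≤-trans; module ≤-Reasoning)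

  fibre : Carrier → List X → List X
  fibre c = filter (λ x → key x ≟ c)

  length-by-fibres : ∀ m B (cs : List Carrier) xs → All (λ x → key x ∈ cs) xs →
                     (∀ c → length (fibre c xs) * m ≤ B) → length xs * m ≤ length cs * B
  length-by-fibres m B []       []      _        _     = z≤n
  length-by-fibres m B []       (_ ∷ _) (() ∷ _) _
  length-by-fibres m B (c ∷ cs) xs      xs⊆c∷cs  bound = begin
    length xs * m                              ≡⟨ ≡.cong (_* m) (length-filter+length-filter-∁ c? xs) ⟨
    (length (fibre c xs) + length rest) * m    ≡⟨ *-distribʳ-+ m (length (fibre c xs)) (length rest) ⟩
    length (fibre c xs) * m + length rest * m  ≤⟨ +-mono-≤ (bound c) rest-by-fibres ⟩
    B + length cs * B                          ∎
    where
    open ≤-Reasoning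
    c? : U.Decidable (λ x → key x ≈ c)
    c? x = key x ≟ c
    rest : List X
    rest = filter (∁? c?) xs
    rest⊆cs : All (λ x → key x ∈ cs) rest
    rest⊆cs = All.zipWith (λ { (here x≈c , x≉c) → contradiction x≈c x≉c ; (there x∈cs , _) → x∈cs })
                          (Allₚ.filter⁺ (∁? c?) xs⊆c∷cs , Allₚ.all-filter (∁? c?) xs)
    fibre-rest⊆fibre : ∀ d → fibre d rest ⊆ fibre d xs
    fibre-rest⊆fibre d = Sublist.filter⁺ (λ x → key x ≟ d) (λ x → key x ≟ d) (λ { ≡.refl p → p })
                                         (Sublist.filter-⊆ (∁? c?) xs)
    rest-bound : ∀ d → length (fibre d rest) * m ≤ B
    rest-bound d = ≤-trans (*-monoˡ-≤ m (Sublist.length-mono-≤ (fibre-rest⊆fibre d))) (bound d)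
    rest-by-fibres : length rest * m ≤ length cs * B
    rest-by-fibres = length-by-fibres m B cs rest rest⊆cs rest-bound

module DualSpace {c ℓ : Level} (F : Field c ℓ) where

  open Field F
  open import Relation.Binary.Reasoning.Setoid setoid
  open import Algebra.Properties.Ring ring using (+-cancelʳ; +-inverseʳ-unique; -‿+-comm; -1*x≈-x; -‿distribʳ-*)
  open import Algebra.Properties.CommutativeSemigroup *-commutativeSemigroup using (x∙yz≈y∙xz; x∙yz≈z∙yx)
  open import Algebra.Properties.CommutativeSemigroup +-commutativeSemigroup
    using () renaming (interchange to +-interchange)
  open import Algebra.Consequences.Setoid setoid using (comm∧almostCancelˡ⇒almostCancelʳ)

  infix  4 _≈ᵛ_ _≈ᵈ_ _⊥_
  infixl 6 _+ᵛ_ _-ᵛ_ _-ᵈ_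
  infixl 7 _·ᵛ_ _·ᵈ_

  _≈ᵛ_ : ∀ {n} → Vec F n → Vec F n → Set ℓ
  _≈ᵛ_ = _≈ᵥ_ F

  _+ᵛ_ : ∀ {n} → Vec F n → Vec F n → Vec F n
  _+ᵛ_ = _+ᵥ_ F

  _·ᵛ_ : ∀ {n} → Carrier → Vec F n → Vec F n
  _·ᵛ_ = _·ᵥ_ F

  _≈ᵈ_ : ∀ {n} → Dual F n → Dual F n → Set (c ⊔ ℓ)
  _≈ᵈ_ = _≈*_ F

  *-almostCancelˡ : AlmostLeftCancellative _≈_ 0# _*_
  *-almostCancelˡ a x y a≉0 ax≈ay = begin
    x             ≈⟨ *-identityˡ x ⟨
    1# * x        ≈⟨ *-congʳ a⁻¹a≈1 ⟨
    (a⁻¹ * a) * x ≈⟨ *-assoc a⁻¹ a x ⟩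
    a⁻¹ * (a * x) ≈⟨ *-congˡ ax≈ay ⟩
    a⁻¹ * (a * y) ≈⟨ *-assoc a⁻¹ a y ⟨
    (a⁻¹ * a) * y ≈⟨ *-congʳ a⁻¹a≈1 ⟩
    1# * y        ≈⟨ *-identityˡ y ⟩
    y             ∎
    where
    a⁻¹ : Carrier
    a⁻¹ = proj₁ (inverse a a≉0)
    a⁻¹a≈1 : a⁻¹ * a ≈ 1#
    a⁻¹a≈1 = trans (*-comm a⁻¹ a) (proj₂ (inverse a a≉0))

  *-almostCancelʳ : AlmostRightCancellative _≈_ 0# _*_
  *-almostCancelʳ = comm∧almostCancelˡ⇒almostCancelʳ *-comm *-almostCancelˡ

  _⊥_ : ∀ {n} → Dual F n → Vec F n → Set ℓ
  φ ⊥ v = app φ v ≈ 0#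

  Orthogonal : ∀ {n} → List (Dual F n) → List (Vec F n) → Set (c ⊔ ℓ)
  Orthogonal Φ D = All (λ φ → All (φ ⊥_) D) Φ

  app-dim0≈0 : (φ : Dual F 0) (v : Vec F 0) → app φ v ≈ 0#
  app-dim0≈0 φ v = begin
    app φ v          ≈⟨ app-cong φ (λ ()) ⟩
    app φ (0# ·ᵛ v)  ≈⟨ homog φ 0# v ⟩
    0# * app φ v     ≈⟨ zeroˡ (app φ v) ⟩
    0#               ∎

  e₀ : ∀ {n} → Vec F (suc n)
  e₀ = 1# Vector.∷ λ _ → 0#

  lead : ∀ {n} → Dual F (suc n) → Carrier
  lead φ = app φ e₀

  restrict : ∀ {n} → Dual F (suc n) → Dual F n
  restrict φ = record
    { app      = λ w → app φ (0# Vector.∷ w)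
    ; app-cong = λ u≈v → app-cong φ λ { zero → refl ; (suc i) → u≈v i }
    ; additive = λ u v → trans (app-cong φ λ { zero → sym (+-identityʳ 0#) ; (suc i) → refl }) (additive φ _ _)
    ; homog    = λ a v → trans (app-cong φ λ { zero → sym (zeroʳ a) ; (suc i) → refl }) (homog φ a _)
    }

  app≈head*lead+restrict : ∀ {n} (φ : Dual F (suc n)) v →
                           app φ v ≈ head v * lead φ + app (restrict φ) (tail v)
  app≈head*lead+restrict φ v = begin
    app φ v                                        ≈⟨ app-cong φ split ⟩
    app φ (head v ·ᵛ e₀ +ᵛ (0# Vector.∷ tail v))   ≈⟨ additive φ _ _ ⟩
    app φ (head v ·ᵛ e₀) + app (restrict φ) (tail v) ≈⟨ +-congʳ (homog φ (head v) e₀) ⟩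
    head v * lead φ + app (restrict φ) (tail v)    ∎
    where
    split : v ≈ᵛ head v ·ᵛ e₀ +ᵛ (0# Vector.∷ tail v)
    split zero    = sym (trans (+-identityʳ _) (*-identityʳ (head v)))
    split (suc i) = sym (trans (+-congʳ (zeroʳ (head v))) (+-identityˡ _))

  ≈ᵛ-from-head-tail : ∀ {n} {u v : Vec F (suc n)} → head u ≈ head v → tail u ≈ᵛ tail v → u ≈ᵛ v
  ≈ᵛ-from-head-tail head≈ tail≈ zero    = head≈
  ≈ᵛ-from-head-tail head≈ tail≈ (suc i) = tail≈ i

  ≈ᵈ-from-lead-restrict : ∀ {n} {φ ψ : Dual F (suc n)} →
                          lead φ ≈ lead ψ → restrict φ ≈ᵈ restrict ψ → φ ≈ᵈ ψ
  ≈ᵈ-from-lead-restrict {φ = φ} {ψ} lead≈ restrict≈ v = begin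
    app φ v                                      ≈⟨ app≈head*lead+restrict φ v ⟩
    head v * lead φ + app (restrict φ) (tail v)  ≈⟨ +-cong (*-congˡ lead≈) (restrict≈ (tail v)) ⟩
    head v * lead ψ + app (restrict ψ) (tail v)  ≈⟨ app≈head*lead+restrict ψ v ⟨
    app ψ v                                      ∎

  restrict-⊥-tail : ∀ {n} {φ : Dual F (suc n)} {v} → lead φ ≈ 0# → φ ⊥ v → restrict φ ⊥ tail v
  restrict-⊥-tail {φ = φ} {v} lead≈0 φ⊥v = begin
    app (restrict φ) (tail v)                    ≈⟨ +-identityˡ _ ⟨
    0# + app (restrict φ) (tail v)               ≈⟨ +-congʳ (trans (*-congˡ lead≈0) (zeroʳ _)) ⟨
    head v * lead φ + app (restrict φ) (tail v)  ≈⟨ app≈head*lead+restrict φ v ⟨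
    app φ v                                      ≈⟨ φ⊥v ⟩
    0#                                           ∎

  _·ᵈ_ : ∀ {n} → Carrier → Dual F n → Dual F n
  a ·ᵈ φ = record
    { app      = λ v → a * app φ v
    ; app-cong = λ u≈v → *-congˡ (app-cong φ u≈v)
    ; additive = λ u v → trans (*-congˡ (additive φ u v)) (distribˡ a _ _)
    ; homog    = λ b v → trans (*-congˡ (homog φ b v)) (x∙yz≈y∙xz a b _)
    }

  _-ᵈ_ : ∀ {n} → Dual F n → Dual F n → Dual F n
  φ -ᵈ ψ = record
    { app      = λ v → app φ v - app ψ v
    ; app-cong = λ u≈v → +-cong (app-cong φ u≈v) (-‿cong (app-cong ψ u≈v))
    ; additive = λ u v → trans (+-cong (additive φ u v) (-‿cong (additive ψ u v)))
                               (trans (+-congˡ (sym (-‿+-comm _ _))) (+-interchange _ _ _ _))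
    ; homog    = λ a v → trans (+-cong (homog φ a v) (-‿cong (homog ψ a v)))
                               (trans (+-congˡ (-‿distribʳ-* a _)) (sym (distribˡ a _ _)))
    }

  module Pivot {n} (φ₀ : Dual F (suc n)) (lead≉0 : ¬ lead φ₀ ≈ 0#) where

    -- The restriction of lead φ₀ · φ − lead φ · φ₀, which vanishes on e₀.
    eliminate : Dual F (suc n) → Dual F n
    eliminate φ = lead φ₀ ·ᵈ restrict φ -ᵈ lead φ ·ᵈ restrict φ₀

    eliminate-injective : ∀ {φ ψ} → lead φ ≈ lead ψ → eliminate φ ≈ᵈ eliminate ψ → φ ≈ᵈ ψ
    eliminate-injective {φ} {ψ} lead≈ elim≈ = ≈ᵈ-from-lead-restrict {φ = φ} {ψ} lead≈ λ w →
      *-almostCancelˡ (lead φ₀) _ _ lead≉0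
        (+-cancelʳ _ _ _ (trans (elim≈ w) (+-congˡ (-‿cong (*-congʳ (sym lead≈))))))

    tail-injective : ∀ {u v} → φ₀ ⊥ u → φ₀ ⊥ v → tail u ≈ᵛ tail v → u ≈ᵛ v
    tail-injective {u} {v} φ₀⊥u φ₀⊥v tail≈ = ≈ᵛ-from-head-tail
      (*-almostCancelʳ (lead φ₀) _ _ lead≉0 (+-cancelʳ (app (restrict φ₀) (tail v)) _ _ (begin
        head u * lead φ₀ + app (restrict φ₀) (tail v)  ≈⟨ +-congˡ (app-cong (restrict φ₀) tail≈) ⟨
        head u * lead φ₀ + app (restrict φ₀) (tail u)  ≈⟨ app≈head*lead+restrict φ₀ u ⟨
        app φ₀ u                                       ≈⟨ trans φ₀⊥u (sym φ₀⊥v) ⟩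
        app φ₀ v                                       ≈⟨ app≈head*lead+restrict φ₀ v ⟩
        head v * lead φ₀ + app (restrict φ₀) (tail v)  ∎)))
      tail≈

    eliminate-⊥-tail : ∀ {φ v} → φ ⊥ v → φ₀ ⊥ v → eliminate φ ⊥ tail v
    eliminate-⊥-tail {φ} {v} φ⊥v φ₀⊥v = begin
      l₀ * app (restrict φ) (tail v) - l * app (restrict φ₀) (tail v)
        ≈⟨ +-cong (*-congˡ (restrict≈ φ φ⊥v)) (-‿cong (*-congˡ (restrict≈ φ₀ φ₀⊥v))) ⟩
      l₀ * - (head v * l) - l * - (head v * l₀)
        ≈⟨ +-cong (-‿distribʳ-* l₀ _) (-‿cong (-‿distribʳ-* l _)) ⟨
      - (l₀ * (head v * l)) - - (l * (head v * l₀))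
        ≈⟨ +-congʳ (-‿cong (x∙yz≈z∙yx l₀ (head v) l)) ⟩
      - (l * (head v * l₀)) - - (l * (head v * l₀))
        ≈⟨ -‿inverseʳ _ ⟩
      0# ∎
      where
      l l₀ : Carrier
      l  = lead φ
      l₀ = lead φ₀
      restrict≈ : ∀ ψ → ψ ⊥ v → app (restrict ψ) (tail v) ≈ - (head v * lead ψ)
      restrict≈ ψ ψ⊥v = +-inverseʳ-unique _ _ (trans (sym (app≈head*lead+restrict ψ v)) ψ⊥v)

  _-ᵛ_ : ∀ {n} → Vec F n → Vec F n → Vec F n
  (u -ᵛ v) i = u i - v i

  -ᵛ-cancelʳ : ∀ {n} {u v w : Vec F n} → u -ᵛ w ≈ᵛ v -ᵛ w → u ≈ᵛ v
  -ᵛ-cancelʳ {w = w} eq i = +-cancelʳ (- w i) _ _ (eq i)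

  app-sub : ∀ {n} (φ : Dual F n) u v → app φ (u -ᵛ v) ≈ app φ u - app φ v
  app-sub φ u v = begin
    app φ (u -ᵛ v)               ≈⟨ app-cong φ (λ i → +-congˡ (-1*x≈-x (v i))) ⟨
    app φ (u +ᵛ - 1# ·ᵛ v)       ≈⟨ additive φ u _ ⟩
    app φ u + app φ (- 1# ·ᵛ v)  ≈⟨ +-congˡ (trans (homog φ (- 1#) v) (-1*x≈-x _)) ⟩
    app φ u - app φ v            ∎

  ∈C⇒app≈ : ∀ {n} {p : Pair F n} {x} → _∈C_ F p x → app (proj₁ p) x ≈ proj₂ p
  ∈C⇒app≈ {x = x} (φ , φ≈ψ , φx≈a) = trans (sym (φ≈ψ x)) φx≈a

  ≈ₚ-from-≈ᵈ : ∀ {n} {p p' : Pair F n} {x} →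
               _∈C_ F p x → _∈C_ F p' x → proj₁ p ≈ᵈ proj₁ p' → _≈ₚ_ F p p'
  ≈ₚ-from-≈ᵈ {p = p} {p'} {x} p∈Cx p'∈Cx φ≈φ' =
    φ≈φ' , trans (sym (∈C⇒app≈ {p = p} p∈Cx)) (trans (φ≈φ' x) (∈C⇒app≈ {p = p'} p'∈Cx))

  ∈C⇒⊥-difference : ∀ {n} {p : Pair F n} {x₀ x} → _∈C_ F p x₀ → _∈C_ F p x → proj₁ p ⊥ x -ᵛ x₀
  ∈C⇒⊥-difference {p = φ , a} {x₀} {x} p∈Cx₀ p∈Cx = begin
    app φ (x -ᵛ x₀)     ≈⟨ app-sub φ x x₀ ⟩
    app φ x - app φ x₀  ≈⟨ +-cong (∈C⇒app≈ {p = φ , a} p∈Cx) (-‿cong (∈C⇒app≈ {p = φ , a} p∈Cx₀)) ⟩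
    a - a               ≈⟨ -‿inverseʳ a ⟩
    0#                  ∎

module Bounds {c ℓ : Level} (F : Field c ℓ) (_≟_ : Decidable (Field._≈_ F))
              (elements : List (Field.Carrier F))
              (complete : ∀ x → SetoidMembership._∈_ (Field.setoid F) x elements) where

  open Field F using (_≈_; 0#; setoid; sym; trans)
  open DualSpace F
  open import Data.Nat using (_*_; _^_; _≤_; z≤n)
  open import Data.Nat.Properties using (*-mono-≤; *-comm)

  q : ℕ
  q = length elements

  OrthogonalBound : ℕ → Set (c ⊔ ℓ)
  OrthogonalBound n = ∀ (Φ : List (Dual F n)) (D : List (Vec F n)) →
                      Distinct _≈ᵈ_ Φ → Distinct _≈ᵛ_ D → Orthogonal Φ D → length D * length Φ ≤ q ^ n

  orthogonal-bound-zero : OrthogonalBound 0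
  orthogonal-bound-zero Φ D Φ! D! _ =
    *-mono-≤ (Distinct-length≤1 (λ u v ()) D!)
             (Distinct-length≤1 (λ φ ψ v → trans (app-dim0≈0 φ v) (sym (app-dim0≈0 ψ v))) Φ!)

  orthogonal-bound-suc-leads≈0 : ∀ {n} → OrthogonalBound n →
    ∀ Φ D → Distinct _≈ᵈ_ Φ → Distinct _≈ᵛ_ D → Orthogonal Φ D →
    All (λ φ → lead φ ≈ 0#) Φ → length D * length Φ ≤ q ^ suc n
  orthogonal-bound-suc-leads≈0 {n} bound Φ D Φ! D! Φ⊥D leads≈0 =
    length-by-fibres (length Φ) (q ^ n) elements D (All.universal (complete ∘ head) D) fibre-bound
    where
    open Fibres setoid _≟_ head
    fibre-bound : ∀ a → length (fibre a D) * length Φ ≤ q ^ n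
    fibre-bound a = ≡.subst (_≤ q ^ n) (≡.cong₂ _*_ (length-map tail (fibre a D)) (length-map restrict Φ))
      (bound (map restrict Φ) (map tail (fibre a D))
        (AllPairs-map⁺-on restrict
          (λ {φ} {ψ} lφ lψ → contraposition (≈ᵈ-from-lead-restrict {φ = φ} {ψ} (trans lφ (sym lψ))))
          leads≈0 Φ!)
        (AllPairs-map⁺-on tail (λ hu hv → contraposition (≈ᵛ-from-head-tail (trans hu (sym hv))))
          (Allₚ.all-filter _ D) (AllPairsₚ.filter⁺ _ D!))
        (All-All-map⁺-on restrict tail (λ {φ} lφ _ → restrict-⊥-tail {φ = φ} lφ)
          leads≈0 (Allₚ.all-filter _ D) (All.map (Allₚ.filter⁺ _) Φ⊥D)))

  orthogonal-bound-suc-pivot : ∀ {n} → OrthogonalBound n →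
    ∀ Φ D → Distinct _≈ᵈ_ Φ → Distinct _≈ᵛ_ D → Orthogonal Φ D →
    (φ₀ : Dual F (suc n)) → ¬ lead φ₀ ≈ 0# → All (φ₀ ⊥_) D → length D * length Φ ≤ q ^ suc n
  orthogonal-bound-suc-pivot {n} bound Φ D Φ! D! Φ⊥D φ₀ lead≉0 φ₀⊥D =
    ≡.subst (_≤ q ^ suc n) (*-comm (length Φ) (length D))
      (length-by-fibres (length D) (q ^ n) elements Φ (All.universal (complete ∘ lead) Φ) fibre-bound)
    where
    open Fibres setoid _≟_ lead
    open Pivot φ₀ lead≉0
    fibre-bound : ∀ a → length (fibre a Φ) * length D ≤ q ^ n
    fibre-bound a = ≡.subst (_≤ q ^ n)
      (≡.trans (≡.cong₂ _*_ (length-map tail D) (length-map eliminate (fibre a Φ))) (*-comm (length D) _))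
      (bound (map eliminate (fibre a Φ)) (map tail D)
        (AllPairs-map⁺-on eliminate
          (λ {φ} {ψ} lφ lψ → contraposition (eliminate-injective {φ} {ψ} (trans lφ (sym lψ))))
          (Allₚ.all-filter _ Φ) (AllPairsₚ.filter⁺ _ Φ!))
        (AllPairs-map⁺-on tail (λ φ₀⊥u φ₀⊥v → contraposition (tail-injective φ₀⊥u φ₀⊥v)) φ₀⊥D D!)
        (All-All-map⁺-on eliminate tail (λ {φ} _ φ₀⊥v φ⊥v → eliminate-⊥-tail {φ} φ⊥v φ₀⊥v)
          (Allₚ.all-filter _ Φ) φ₀⊥D (Allₚ.filter⁺ _ Φ⊥D)))

  orthogonal-bound : ∀ n → OrthogonalBound n
  orthogonal-bound zero = orthogonal-bound-zero
  orthogonal-bound (suc n) Φ D Φ! D! Φ⊥D with All.all? (λ φ → lead φ ≟ 0#) Φ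
  ... | yes leads≈0 = orthogonal-bound-suc-leads≈0 (orthogonal-bound n) Φ D Φ! D! Φ⊥D leads≈0
  ... | no ¬leads≈0 = orthogonal-bound-suc-pivot (orthogonal-bound n) Φ D Φ! D! Φ⊥D
                        φ₀ (proj₂ φ₀⊥D×lead≉0) (proj₁ φ₀⊥D×lead≉0)
    where
    lead≉0-somewhere : Any (λ φ → ¬ lead φ ≈ 0#) Φ
    lead≉0-somewhere = Allₚ.¬All⇒Any¬ (λ φ → lead φ ≟ 0#) Φ ¬leads≈0
    φ₀ : Dual F (suc n)
    φ₀ = Any.lookup lead≉0-somewhere
    φ₀⊥D×lead≉0 : All (φ₀ ⊥_) D × ¬ lead φ₀ ≈ 0#
    φ₀⊥D×lead≉0 = All.lookupAny Φ⊥D lead≉0-somewhere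

  solution-set-bound : ∀ n (S : List (Pair F n)) → Distinct (_≈ₚ_ F) S →
                       (A : List (Vec F n)) → Distinct _≈ᵛ_ A → All (λ x → _∈A_ F x S) A →
                       length A * length S ≤ q ^ n
  solution-set-bound n S S! []       _  _                   = z≤n
  solution-set-bound n S S! (x₀ ∷ A) A! A⊆A_S@(x₀∈A_S ∷ _) =
    ≡.subst (_≤ q ^ n) (≡.cong₂ _*_ (length-map (_-ᵛ x₀) (x₀ ∷ A)) (length-map proj₁ S))
      (orthogonal-bound n (map proj₁ S) (map (_-ᵛ x₀) (x₀ ∷ A))
        (AllPairs-map⁺-on proj₁
          (λ {p} {p'} p∈Cx₀ p'∈Cx₀ → contraposition (≈ₚ-from-≈ᵈ {p = p} {p'} p∈Cx₀ p'∈Cx₀))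
          x₀∈A_S S!)
        (AllPairsₚ.map⁺ (AllPairs.map (contraposition -ᵛ-cancelʳ) A!))
        (All-All-map⁺-on proj₁ (_-ᵛ x₀) (λ {p} p∈Cx₀ _ → ∈C⇒⊥-difference {p = p} p∈Cx₀)
          x₀∈A_S A⊆A_S (Allₚ.All-swap A⊆A_S)))

module FiniteSetoid {a ℓ : Level} {q : ℕ} {S : Setoid a ℓ} (Fin≅S : Bijection (≡.setoid (Fin q)) S) where

  open Setoid S using (Carrier; _≈_; reflexive; sym; trans)
  open SetoidMembership S using (_∈_)
  open Bijection Fin≅S using (to; injective; surjection)
  open Surjection surjection using (to⁻; to∘to⁻)

  enumeration : List Carrier
  enumeration = tabulate to

  ∈-enumeration : ∀ x → x ∈ enumeration
  ∈-enumeration x = SetoidMembershipₚ.∈-resp-≈ S (to∘to⁻ x) (SetoidMembershipₚ.∈-tabulate⁺ S (to⁻ x))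

  _≟_ : Decidable _≈_
  x ≟ y = map′ (λ i≡j → trans (sym (to∘to⁻ x)) (trans (reflexive (≡.cong to i≡j)) (to∘to⁻ y)))
               (λ x≈y → injective (trans (to∘to⁻ x) (trans x≈y (sym (to∘to⁻ y)))))
               (to⁻ x Fin.≟ to⁻ y)

open import Data.Nat using (_*_; _^_; _≤_)
open import Relation.Binary.PropositionalEquality using (setoid)

mainTheorem2 : ∀ {c ℓ : Level} (F : Field c ℓ) (q n : ℕ)
  → Bijection (setoid (Fin q)) (Field.setoid F)
  → (S : List (Pair F n)) → AllPairs (λ s t → ¬ (_≈ₚ_ F s t)) S
  → (A : List (Vec F n)) → AllPairs (λ x y → ¬ (_≈ᵥ_ F x y)) A
  → All (λ x → _∈A_ F x S) A
  → length A * length S ≤ q ^ n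
mainTheorem2 F q n Fin≅F S S! A A! A⊆A_S =
  ≡.subst (λ m → length A * length S ≤ m ^ n) (length-tabulate to)
    (solution-set-bound n S S! A A! A⊆A_S)
  where
  open FiniteSetoid Fin≅F
  open Bijection Fin≅F using (to)
  open Bounds F _≟_ enumeration ∈-enumeration
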